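{- Every model of $\mathsf{DB}_0$ has a proper end extension that is also a model of $\mathsf{DB}_0$.
   Context: Language $\mathcal{L}_\in=\{\in,=\}$. $\mathsf{DB}_0$ consists of extensionality, nullset, pairing, union, cartesian product and $\Delta_0$-separation. For $\mathcal{L}_\in$-structures $\mathcal{M}=(M,\in^{\mathcal{M}})\subseteq\mathcal{N}=(N,\in^{\mathcal{N}})$ ($\mathcal{M}$ a substructure of $\mathcal{N}$), $\mathcal{N}$ is an end extension of $\mathcal{M}$ if for every $m\in M$ and $n\in N$, $\mathcal{N}\vDash n\in m$ implies $n\in M$; it is proper if $M\neq N$. -}

module Defs where

open import Data.Nat using (ℕ; zero; suc)
open import Data.Fin using (Fin; zero; suc)
open import Data.Product using (Σ; _×_; _,_; ∃)
open import Data.Sum using (_⊎_)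
open import Data.Empty using (⊥)
open import Relation.Nullary using (¬_)
open import Relation.Binary.PropositionalEquality using (_≡_)
open import Function.Bundles using (_⇔_)

-- An L_∈-structure: a carrier with a binary membership relation.
-- Equality of the language is interpreted as identity (≡) on the carrier.
record Structure : Set₁ where
  field
    Carrier : Set
    _∈_     : Carrier → Carrier → Set

-- Δ₀-formulas of L_∈ with n free variables (de Bruijn, variable 0 = innermost).
data Δ₀ (n : ℕ) : Set where
  _∈'_ : Fin n → Fin n → Δ₀ n
  _≐_  : Fin n → Fin n → Δ₀ n
  ⊥'   : Δ₀ n
  _⇒_  : Δ₀ n → Δ₀ n → Δ₀ n
  _∧'_ : Δ₀ n → Δ₀ n → Δ₀ n
  _∨'_ : Δ₀ n → Δ₀ n → Δ₀ n
  -- bounded quantifiers: ∀ y ∈ xᵢ. φ  and  ∃ y ∈ xᵢ. φ  (y becomes variable 0)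
  ∀∈   : Fin n → Δ₀ (suc n) → Δ₀ n
  ∃∈   : Fin n → Δ₀ (suc n) → Δ₀ n

_∷ₑ_ : {A : Set} {n : ℕ} → A → (Fin n → A) → Fin (suc n) → A
(a ∷ₑ ρ) zero    = a
(a ∷ₑ ρ) (suc i) = ρ i

module _ (𝓜 : Structure) where
  open Structure 𝓜

  Sat : {n : ℕ} → Δ₀ n → (Fin n → Carrier) → Set
  Sat (i ∈' j) ρ = ρ i ∈ ρ j
  Sat (i ≐ j)  ρ = ρ i ≡ ρ j
  Sat ⊥'       ρ = ⊥
  Sat (φ ⇒ ψ)  ρ = Sat φ ρ → Sat ψ ρ
  Sat (φ ∧' ψ) ρ = Sat φ ρ × Sat ψ ρ
  Sat (φ ∨' ψ) ρ = Sat φ ρ ⊎ Sat ψ ρ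
  Sat (∀∈ i φ) ρ = (y : Carrier) → y ∈ ρ i → Sat φ (y ∷ₑ ρ)
  Sat (∃∈ i φ) ρ = Σ Carrier λ y → (y ∈ ρ i) × Sat φ (y ∷ₑ ρ)

  IsSingleton : Carrier → Carrier → Set
  IsSingleton a u = u ∈ a × ((b : Carrier) → b ∈ a → b ≡ u)

  IsUPair : Carrier → Carrier → Carrier → Set
  IsUPair a u v = u ∈ a × v ∈ a × ((b : Carrier) → b ∈ a → b ≡ u ⊎ b ≡ v)

  IsOPair : Carrier → Carrier → Carrier → Set
  IsOPair w u v =
    (Σ Carrier λ a → a ∈ w × IsSingleton a u) ×
    (Σ Carrier λ a → a ∈ w × IsUPair a u v) ×
    ((a : Carrier) → a ∈ w → IsSingleton a u ⊎ IsUPair a u v)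

  record ModelDB₀ : Set where
    field
      extensionality : (x y : Carrier) → ((z : Carrier) → z ∈ x ⇔ z ∈ y) → x ≡ y
      nullset        : Σ Carrier λ x → (y : Carrier) → ¬ (y ∈ x)
      pairing        : (x y : Carrier) → Σ Carrier λ z →
                         (w : Carrier) → w ∈ z ⇔ (w ≡ x ⊎ w ≡ y)
      union          : (x : Carrier) → Σ Carrier λ z →
                         (w : Carrier) → w ∈ z ⇔ (Σ Carrier λ u → u ∈ x × w ∈ u)
      product        : (x y : Carrier) → Σ Carrier λ z →
                         (w : Carrier) → w ∈ z ⇔
                           (Σ Carrier λ u → Σ Carrier λ v → u ∈ x × v ∈ y × IsOPair w u v)
      Δ₀-separation  : {n : ℕ} (φ : Δ₀ (suc n)) (ps : Fin n → Carrier) (x : Carrier) →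
                         Σ Carrier λ y → (z : Carrier) → z ∈ y ⇔ (z ∈ x × Sat φ (z ∷ₑ ps))

-- 𝓝 is a (proper) end extension of 𝓜, up to isomorphism of 𝓜 with its image:
-- an injective embedding preserving and reflecting ∈ whose image is
-- downward closed under ∈ of 𝓝.
record EndExtension (𝓜 𝓝 : Structure) : Set where
  module M = Structure 𝓜
  module N = Structure 𝓝
  field
    emb       : M.Carrier → N.Carrier
    injective : (x y : M.Carrier) → emb x ≡ emb y → x ≡ y
    ∈-iff     : (x y : M.Carrier) → x M.∈ y ⇔ emb x N.∈ emb y
    end       : (m : M.Carrier) (n : N.Carrier) → n N.∈ emb m →
                  Σ M.Carrier λ m' → emb m' ≡ n

record ProperEndExtension (𝓜 𝓝 : Structure) : Set where
  field
    endExt : EndExtension 𝓜 𝓝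
    proper : Σ (Structure.Carrier 𝓝) λ n →
               (m : Structure.Carrier 𝓜) → ¬ (EndExtension.emb endExt m ≡ n)

{-# OPTIONS --safe #-}

-- Work classically inside 𝓜.  Code each set m of 𝓜 by ⌜m⌝ = {∅, m}; let ⋆ = {{{∅}}}, which is
-- no code, stand for a new element with ⋆ ∈ ⋆ (DB₀ has no foundation); and let every other,
-- "plain", set of 𝓜 stand for the set of its own members.  The resulting membership ∈ᴺ is
-- Δ₀-definable in 𝓜 from the parameters ∅ and ⋆.  Restricting to the sets all of whose
-- ∈ᴺ-descendants are good (have a member that is no code and a member other than ⋆) makes ∈ᴺ
-- extensional and gives the structure 𝓝.  Since the ∈ᴺ-members of a set always lie in a set of
-- 𝓜, a Δ₀-formula about 𝓝 translates into a Δ₀-formula about 𝓜 whose quantifiers range over a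
-- sufficiently large set, and the axioms of 𝓝, separation included, reduce to those of 𝓜.
-- Finally m ↦ ⌜m⌝ is an end embedding, as the ∈ᴺ-members of ⌜m⌝ are the codes of members of m,
-- and ⋆ lies outside its image.

module Submission where

open import Defs
open import Level using (0ℓ)
open import Axiom.ExcludedMiddle using (ExcludedMiddle)
open import Data.Nat using (ℕ; zero; suc; _+_; _⊔_; _≤_; s≤s)
open import Data.Nat.Properties using (≤-refl; m⊔n≤o⇒m≤o; m⊔n≤o⇒n≤o)
open import Data.Fin using (Fin; zero; suc; #_; _↑ˡ_; _↑ʳ_)
open import Data.Product using (Σ; _×_; _,_; proj₁; proj₂)
open import Data.Sum as Sum using (_⊎_; inj₁; inj₂)
open import Data.Empty using (⊥-elim)
open import Data.Unit using (⊤; tt)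
open import Relation.Nullary using (¬_; yes; no)
open import Axiom.DoubleNegationElimination using (em⇒dne)
open import Relation.Binary.Construct.Closure.ReflexiveTransitive using (Star; ε; _◅_)
open import Relation.Binary.PropositionalEquality using (_≡_; refl; sym; trans; cong; subst)
open import Function using (_∘_; id)
open import Function.Bundles using (_⇔_; mk⇔; Equivalence)
open import Function.Construct.Identity using (⇔-id)
open import Function.Properties.Equivalence using () renaming (trans to ⇔-trans)
open import Function.Related.TypeIsomorphisms using (→-cong-⇔)
open import Data.Product.Function.NonDependent.Propositional using (_×-⇔_)
open import Data.Sum.Function.Propositional using (_⊎-⇔_)
open import Data.Vec.Functional using (_++_)
open import Data.Vec.Functional.Properties using (lookup-++ˡ; lookup-++ʳ)
open import Data.Refinement using (Refinement-syntax; _,_; value; value-injective)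
open import Data.Irrelevant using ([_])
import Data.Empty.Irrelevant as Irrelevant

open Equivalence using (to; from)

Extensionality : Structure → Set
Extensionality 𝓐 = (x y : Carrier) → ((z : Carrier) → z ∈ x ⇔ z ∈ y) → x ≡ y
  where open Structure 𝓐

Δ₀-Separation : Structure → Set
Δ₀-Separation 𝓐 = {n : ℕ} (φ : Δ₀ (suc n)) (ps : Fin n → Carrier) (x : Carrier) →
  Σ Carrier λ y → (z : Carrier) → z ∈ y ⇔ (z ∈ x × Sat 𝓐 φ (z ∷ₑ ps))
  where open Structure 𝓐

-- Sat 𝓐 (UPairF a u v) σ computes to IsUPair 𝓐 (σ a) (σ u) (σ v), and likewise for the others.
SingletonF : {m : ℕ} → Fin m → Fin m → Δ₀ m
SingletonF a u = (u ∈' a) ∧' ∀∈ a (zero ≐ suc u)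

UPairF : {m : ℕ} → Fin m → Fin m → Fin m → Δ₀ m
UPairF a u v = (u ∈' a) ∧' ((v ∈' a) ∧' ∀∈ a ((zero ≐ suc u) ∨' (zero ≐ suc v)))

OPairF : {m : ℕ} → Fin m → Fin m → Fin m → Δ₀ m
OPairF w u v =
  ∃∈ w (SingletonF zero (suc u)) ∧'
  (∃∈ w (UPairF zero (suc u) (suc v)) ∧'
   ∀∈ w (SingletonF zero (suc u) ∨' UPairF zero (suc u) (suc v)))

module StructureProperties (𝓐 : Structure) where
  open Structure 𝓐

  IsSingleton⇒IsUPair : {a u : Carrier} → IsSingleton 𝓐 a u → IsUPair 𝓐 a u u
  IsSingleton⇒IsUPair (u∈a , only-u) = u∈a , u∈a , λ b b∈a → inj₁ (only-u b b∈a)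

  IsUPair-cancelˡ : {a u v v′ : Carrier} → IsUPair 𝓐 a u v → IsUPair 𝓐 a u v′ → v ≡ v′
  IsUPair-cancelˡ (_ , v∈a , only) (_ , v′∈a , only′) with only′ _ v∈a | only _ v′∈a
  ... | inj₂ v≡v′ | _         = v≡v′
  ... | inj₁ v≡u  | inj₁ v′≡u = trans v≡u (sym v′≡u)
  ... | inj₁ _    | inj₂ v′≡v = sym v′≡v

  module _ (ext : Extensionality 𝓐) where

    IsUPair-unique : {a b u v : Carrier} → IsUPair 𝓐 a u v → IsUPair 𝓐 b u v → a ≡ b
    IsUPair-unique (u∈a , v∈a , only-a) (u∈b , v∈b , only-b) =
      ext _ _ λ z → mk⇔ (either u∈b v∈b ∘ only-a z) (either u∈a v∈a ∘ only-b z)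
      where
      either : {c z u v : Carrier} → u ∈ c → v ∈ c → z ≡ u ⊎ z ≡ v → z ∈ c
      either u∈c _ (inj₁ refl) = u∈c
      either _ v∈c (inj₂ refl) = v∈c

    IsOPair-unfold : {w u v : Carrier} → IsOPair 𝓐 w u v →
      Σ Carrier λ s → Σ Carrier λ p → IsUPair 𝓐 s u u × IsUPair 𝓐 p u v × IsUPair 𝓐 w s p
    IsOPair-unfold ((s , s∈w , s-sing) , (p , p∈w , p-upair) , only) =
      s , p , IsSingleton⇒IsUPair s-sing , p-upair , s∈w , p∈w , λ c c∈w → component (only c c∈w)
      where
      component : {c : Carrier} → IsSingleton 𝓐 c _ ⊎ IsUPair 𝓐 c _ _ → c ≡ s ⊎ c ≡ p
      component (inj₁ c-sing)  =
        inj₁ (IsUPair-unique (IsSingleton⇒IsUPair c-sing) (IsSingleton⇒IsUPair s-sing))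
      component (inj₂ c-upair) = inj₂ (IsUPair-unique c-upair p-upair)

  module _ (separation : Δ₀-Separation 𝓐) where

    product-from-bound : (x y p : Carrier) →
      ((w u v : Carrier) → u ∈ x → v ∈ y → IsOPair 𝓐 w u v → w ∈ p) →
      Σ Carrier λ z → (w : Carrier) → w ∈ z ⇔
        (Σ Carrier λ u → Σ Carrier λ v → u ∈ x × v ∈ y × IsOPair 𝓐 w u v)
    product-from-bound x y p pairs∈p
      with separation {n = 2} (∃∈ (# 1) (∃∈ (# 3) (OPairF (# 2) (# 1) (# 0)))) (x ∷ₑ (y ∷ₑ λ ())) p
    ... | z , ∈z = z , λ w → mk⇔
      (λ w∈z → let (u , u∈x , v , v∈y , w≡⟨u,v⟩) = proj₂ (to (∈z w) w∈z) in
               u , v , u∈x , v∈y , w≡⟨u,v⟩)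
      (λ (u , v , u∈x , v∈y , w≡⟨u,v⟩) →
        from (∈z w) (pairs∈p w u v u∈x v∈y w≡⟨u,v⟩ , u , u∈x , v , v∈y , w≡⟨u,v⟩))

module DB₀Sets (𝓜 : Structure) (MD : ModelDB₀ 𝓜) where
  open Structure 𝓜 renaming (Carrier to M)
  open ModelDB₀ MD
  open StructureProperties 𝓜 public

  extensional : {x y : M} → ((z : M) → z ∈ x → z ∈ y) → ((z : M) → z ∈ y → z ∈ x) → x ≡ y
  extensional x⊆y y⊆x = extensionality _ _ λ z → mk⇔ (x⊆y z) (y⊆x z)

  ∅ : M
  ∅ = proj₁ nullset

  ∉∅ : {y : M} → ¬ (y ∈ ∅)
  ∉∅ = proj₂ nullset _

  pair : M → M → M
  pair a b = proj₁ (pairing a b)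

  ∈-pair⁻ : {a b w : M} → w ∈ pair a b → w ≡ a ⊎ w ≡ b
  ∈-pair⁻ = to (proj₂ (pairing _ _) _)

  ∈-pair⁺ : {a b w : M} → w ≡ a ⊎ w ≡ b → w ∈ pair a b
  ∈-pair⁺ = from (proj₂ (pairing _ _) _)

  ∈-pair⁺ˡ : {a b : M} → a ∈ pair a b
  ∈-pair⁺ˡ = ∈-pair⁺ (inj₁ refl)

  ∈-pair⁺ʳ : {a b : M} → b ∈ pair a b
  ∈-pair⁺ʳ = ∈-pair⁺ (inj₂ refl)

  pair-IsUPair : (a b : M) → IsUPair 𝓜 (pair a b) a b
  pair-IsUPair a b = ∈-pair⁺ˡ , ∈-pair⁺ʳ , λ _ → ∈-pair⁻

  sing : M → M
  sing a = pair a a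

  ∈-sing : (a : M) → a ∈ sing a
  ∈-sing a = ∈-pair⁺ˡ

  ∈-sing⁻ : {a w : M} → w ∈ sing a → w ≡ a
  ∈-sing⁻ w∈a with ∈-pair⁻ w∈a
  ... | inj₁ w≡a = w≡a
  ... | inj₂ w≡a = w≡a

  sing-IsSingleton : (a : M) → IsSingleton 𝓜 (sing a) a
  sing-IsSingleton a = ∈-sing a , λ _ → ∈-sing⁻

  ⋃ : M → M
  ⋃ x = proj₁ (union x)

  ∈-⋃⁺ : {x u w : M} → u ∈ x → w ∈ u → w ∈ ⋃ x
  ∈-⋃⁺ {u = u} u∈x w∈u = from (proj₂ (union _) _) (u , u∈x , w∈u)

  ∈-⋃⁻ : {x w : M} → w ∈ ⋃ x → Σ M λ u → u ∈ x × w ∈ u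
  ∈-⋃⁻ = to (proj₂ (union _) _)

  infixl 25 _∪_
  _∪_ : M → M → M
  a ∪ b = ⋃ (pair a b)

  ∈-∪⁺ˡ : {a b w : M} → w ∈ a → w ∈ a ∪ b
  ∈-∪⁺ˡ = ∈-⋃⁺ ∈-pair⁺ˡ

  ∈-∪⁺ʳ : {a b w : M} → w ∈ b → w ∈ a ∪ b
  ∈-∪⁺ʳ = ∈-⋃⁺ ∈-pair⁺ʳ

  ∈-∪⁻ : {a b w : M} → w ∈ a ∪ b → w ∈ a ⊎ w ∈ b
  ∈-∪⁻ w∈a∪b with ∈-⋃⁻ w∈a∪b
  ... | u , u∈ab , w∈u with ∈-pair⁻ u∈ab
  ... | inj₁ refl = inj₁ w∈u
  ... | inj₂ refl = inj₂ w∈u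

  sep : {n : ℕ} → Δ₀ (suc n) → (Fin n → M) → M → M
  sep φ ps x = proj₁ (Δ₀-separation φ ps x)

  ∈-sep⁺ : {n : ℕ} (φ : Δ₀ (suc n)) {ps : Fin n → M} {x z : M} →
           z ∈ x → Sat 𝓜 φ (z ∷ₑ ps) → z ∈ sep φ ps x
  ∈-sep⁺ φ {ps} {x} z∈x sat = from (proj₂ (Δ₀-separation φ ps x) _) (z∈x , sat)

  ∈-sep⁻ : {n : ℕ} (φ : Δ₀ (suc n)) {ps : Fin n → M} {x z : M} →
           z ∈ sep φ ps x → z ∈ x × Sat 𝓜 φ (z ∷ₑ ps)
  ∈-sep⁻ φ {ps} {x} = to (proj₂ (Δ₀-separation φ ps x) _)

  infixr 26 _⊗_
  _⊗_ : M → M → M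
  x ⊗ y = proj₁ (product x y)

  ∈-⊗⁺ : {x y u v w : M} → u ∈ x → v ∈ y → IsOPair 𝓜 w u v → w ∈ x ⊗ y
  ∈-⊗⁺ {u = u} {v} u∈x v∈y w≡⟨u,v⟩ = from (proj₂ (product _ _) _) (u , v , u∈x , v∈y , w≡⟨u,v⟩)

  ∈-⊗⁻ : {x y w : M} → w ∈ x ⊗ y → Σ M λ u → Σ M λ v → u ∈ x × v ∈ y × IsOPair 𝓜 w u v
  ∈-⊗⁻ = to (proj₂ (product _ _) _)

  -- {u, v} ∈ ⟨u, v⟩ = {{u}, {u, v}} ∈ x ⊗ y
  IsUPair-∈-⋃⊗ : {x y t u v : M} → u ∈ x → v ∈ y → IsUPair 𝓜 t u v → t ∈ ⋃ (x ⊗ y)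
  IsUPair-∈-⋃⊗ {t = t} {u} {v} u∈x v∈y t-upair = ∈-⋃⁺ (∈-⊗⁺ u∈x v∈y kuratowski) ∈-pair⁺ʳ
    where
    kuratowski : IsOPair 𝓜 (pair (sing u) t) u v
    kuratowski = (sing u , ∈-pair⁺ˡ , sing-IsSingleton u) , (t , ∈-pair⁺ʳ , t-upair) , component
      where
      component : (c : M) → c ∈ pair (sing u) t → IsSingleton 𝓜 c u ⊎ IsUPair 𝓜 c u v
      component c c∈w with ∈-pair⁻ c∈w
      ... | inj₁ refl = inj₁ (sing-IsSingleton u)
      ... | inj₂ refl = inj₂ t-upair

  ∈-⋃⊗⁻ : {x y t : M} → t ∈ ⋃ (x ⊗ y) →
          Σ M λ u → Σ M λ v → u ∈ x × (v ∈ x ⊎ v ∈ y) × IsUPair 𝓜 t u v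
  ∈-⋃⊗⁻ t∈⋃ with ∈-⋃⁻ t∈⋃
  ... | w , w∈x⊗y , t∈w with ∈-⊗⁻ w∈x⊗y
  ... | u , v , u∈x , v∈y , (_ , _ , component) with component _ t∈w
  ... | inj₁ t-sing  = u , u , u∈x , inj₁ u∈x , IsSingleton⇒IsUPair t-sing
  ... | inj₂ t-upair = u , v , u∈x , inj₂ v∈y , t-upair

  enumerate : {n : ℕ} (f : Fin n → M) → Σ M λ A → (i : Fin n) → f i ∈ A
  enumerate {zero} f = ∅ , λ ()
  enumerate {suc n} f with enumerate (f ∘ suc)
  ... | A , f∈A = sing (f zero) ∪ A , λ { zero → ∈-∪⁺ˡ (∈-sing _) ; (suc i) → ∈-∪⁺ʳ (f∈A i) }

module Construction (em : ExcludedMiddle 0ℓ) (𝓜 : Structure) (MD : ModelDB₀ 𝓜) where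
  open Structure 𝓜 renaming (Carrier to M)
  open ModelDB₀ MD using (extensionality)
  open DB₀Sets 𝓜 MD

  ⋆ : M
  ⋆ = sing (sing (sing ∅))

  -- Parametrised by the sets playing ∅ and ⋆ so that the Δ₀-formulas IsCodeF, ∈ᴺF and GoodF
  -- below are satisfied exactly when these predicates hold, by computation of Sat.
  module Coding (e o : M) where

    IsCode : M → Set
    IsCode b = Σ M λ y → y ∈ b × IsUPair 𝓜 b e y

    _∈ᴺ_ : M → M → Set
    a ∈ᴺ b = (Σ M λ y → y ∈ b × (IsUPair 𝓜 b e y × (Σ M λ z → z ∈ y × IsUPair 𝓜 a e z)))
           ⊎ ((b ≡ o × a ≡ o) ⊎ (¬ IsCode b × (¬ b ≡ o × a ∈ b)))

    -- A good plain set has an 𝓝-extension different from that of every code and of ⋆.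
    Good : M → Set
    Good t = (Σ M λ c → c ∈ t × ¬ IsCode c) × (Σ M λ c → c ∈ t × ¬ c ≡ o)

  open Coding ∅ ⋆

  IsCodeF : {m : ℕ} → Fin m → Fin m → Δ₀ m
  IsCodeF b e = ∃∈ b (UPairF (suc b) (suc e) zero)

  ∈ᴺF : {m : ℕ} → Fin m → Fin m → Fin m → Fin m → Δ₀ m
  ∈ᴺF a b e o =
    ∃∈ b (UPairF (suc b) (suc e) zero ∧' ∃∈ zero (UPairF (suc (suc a)) (suc (suc e)) zero))
    ∨' (((b ≐ o) ∧' (a ≐ o)) ∨' ((IsCodeF b e ⇒ ⊥') ∧' (((b ≐ o) ⇒ ⊥') ∧' (a ∈' b))))

  GoodF : Δ₀ 3
  GoodF = ∃∈ (# 0) (IsCodeF (# 0) (# 2) ⇒ ⊥') ∧' ∃∈ (# 0) (((# 0) ≐ (# 3)) ⇒ ⊥')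

  dne : {P : Set} → ¬ ¬ P → P
  dne = em⇒dne em

  ⌜_⌝ : M → M
  ⌜ y ⌝ = pair ∅ y

  ⌜⌝-IsUPair : (y : M) → IsUPair 𝓜 ⌜ y ⌝ ∅ y
  ⌜⌝-IsUPair = pair-IsUPair ∅

  ⌜⌝-IsCode : (y : M) → IsCode ⌜ y ⌝
  ⌜⌝-IsCode y = y , ∈-pair⁺ʳ , ⌜⌝-IsUPair y

  IsUPair⇒≡⌜⌝ : {b y : M} → IsUPair 𝓜 b ∅ y → b ≡ ⌜ y ⌝
  IsUPair⇒≡⌜⌝ b-upair = IsUPair-unique extensionality b-upair (⌜⌝-IsUPair _)

  ⌜⌝-injective : {y y′ : M} → ⌜ y ⌝ ≡ ⌜ y′ ⌝ → y ≡ y′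
  ⌜⌝-injective {y} {y′} eq =
    IsUPair-cancelˡ (⌜⌝-IsUPair y) (subst (λ b → IsUPair 𝓜 b ∅ y′) (sym eq) (⌜⌝-IsUPair y′))

  ∅∉⇒¬IsCode : {b : M} → ¬ (∅ ∈ b) → ¬ IsCode b
  ∅∉⇒¬IsCode ∅∉b (_ , _ , ∅∈b , _) = ∅∉b ∅∈b

  ∅∉sing²∅ : ¬ (∅ ∈ sing (sing ∅))
  ∅∉sing²∅ ∅∈ = ∉∅ (subst (∅ ∈_) (sym (∈-sing⁻ ∅∈)) (∈-sing ∅))

  ¬IsCode-⋆ : ¬ IsCode ⋆
  ¬IsCode-⋆ = ∅∉⇒¬IsCode λ ∅∈⋆ → ∉∅ (subst (sing ∅ ∈_) (sym (∈-sing⁻ ∅∈⋆)) (∈-sing (sing ∅)))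

  sing²∅≢⋆ : ¬ (sing (sing ∅) ≡ ⋆)
  sing²∅≢⋆ eq = ∅∉sing²∅ (subst (∅ ∈_) (∈-sing⁻ (subst (sing ∅ ∈_) eq (∈-sing (sing ∅)))) (∈-sing ∅))

  ⋆≢∅ : ¬ (⋆ ≡ ∅)
  ⋆≢∅ eq = ∉∅ (subst (sing (sing ∅) ∈_) eq (∈-sing (sing (sing ∅))))

  Good-⋆ : Good ⋆
  Good-⋆ = (_ , ∈-sing _ , ∅∉⇒¬IsCode ∅∉sing²∅) , (_ , ∈-sing _ , sing²∅≢⋆)

  Good-⌜⌝ : (y : M) → Good ⌜ y ⌝
  Good-⌜⌝ y = (∅ , ∈-pair⁺ˡ , ∅∉⇒¬IsCode ∉∅) , (∅ , ∈-pair⁺ˡ , λ ∅≡⋆ → ⋆≢∅ (sym ∅≡⋆))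

  ¬Good-∅ : ¬ Good ∅
  ¬Good-∅ ((_ , c∈∅ , _) , _) = ∉∅ c∈∅

  ¬Good-sing²∅ : ¬ Good (sing (sing ∅))
  ¬Good-sing²∅ ((c , c∈ , ¬code) , _) = ¬code (subst IsCode (sym (∈-sing⁻ c∈)) (⌜⌝-IsCode ∅))

  data Kind : M → Set where
    code  : (y : M) → Kind ⌜ y ⌝
    atom  : Kind ⋆
    plain : {b : M} → ¬ IsCode b → ¬ b ≡ ⋆ → Kind b

  kind : (b : M) → Kind b
  kind b with em {IsCode b} | em {b ≡ ⋆}
  ... | yes (y , _ , b-upair) | _        = subst Kind (sym (IsUPair⇒≡⌜⌝ b-upair)) (code y)
  ... | no _                  | yes refl = atom
  ... | no ¬code              | no ¬atom = plain ¬code ¬atom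

  ∈ᴺ-⌜⌝⁺ : {y z : M} → z ∈ y → ⌜ z ⌝ ∈ᴺ ⌜ y ⌝
  ∈ᴺ-⌜⌝⁺ {y} {z} z∈y = inj₁ (y , ∈-pair⁺ʳ , ⌜⌝-IsUPair y , z , z∈y , ⌜⌝-IsUPair z)

  ∈ᴺ-⌜⌝⁻ : {a y : M} → a ∈ᴺ ⌜ y ⌝ → Σ M λ z → z ∈ y × a ≡ ⌜ z ⌝
  ∈ᴺ-⌜⌝⁻ (inj₁ (_ , _ , ⌜y⌝-upair , z , z∈y′ , a-upair)) with IsUPair-cancelˡ (⌜⌝-IsUPair _) ⌜y⌝-upair
  ... | refl = z , z∈y′ , IsUPair⇒≡⌜⌝ a-upair
  ∈ᴺ-⌜⌝⁻ (inj₂ (inj₁ (⌜y⌝≡⋆ , _))) = ⊥-elim (¬IsCode-⋆ (subst IsCode ⌜y⌝≡⋆ (⌜⌝-IsCode _)))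
  ∈ᴺ-⌜⌝⁻ (inj₂ (inj₂ (¬code , _))) = ⊥-elim (¬code (⌜⌝-IsCode _))

  ⋆∈ᴺ⋆ : ⋆ ∈ᴺ ⋆
  ⋆∈ᴺ⋆ = inj₂ (inj₁ (refl , refl))

  ∈ᴺ-⋆⁻ : {a : M} → a ∈ᴺ ⋆ → a ≡ ⋆
  ∈ᴺ-⋆⁻ (inj₁ (y , y∈⋆ , ⋆-upair , _)) = ⊥-elim (¬IsCode-⋆ (y , y∈⋆ , ⋆-upair))
  ∈ᴺ-⋆⁻ (inj₂ (inj₁ (_ , a≡⋆)))       = a≡⋆
  ∈ᴺ-⋆⁻ (inj₂ (inj₂ (_ , ⋆≢⋆ , _)))   = ⊥-elim (⋆≢⋆ refl)

  ∈ᴺ-plain : {a b : M} → ¬ IsCode b → ¬ b ≡ ⋆ → a ∈ᴺ b ⇔ a ∈ b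
  ∈ᴺ-plain {a} {b} ¬code ¬atom = mk⇔ ∈ᴺ⇒∈ λ a∈b → inj₂ (inj₂ (¬code , ¬atom , a∈b))
    where
    ∈ᴺ⇒∈ : a ∈ᴺ b → a ∈ b
    ∈ᴺ⇒∈ (inj₁ (y , y∈b , b-upair , _))  = ⊥-elim (¬code (y , y∈b , b-upair))
    ∈ᴺ⇒∈ (inj₂ (inj₁ (b≡⋆ , _)))         = ⊥-elim (¬atom b≡⋆)
    ∈ᴺ⇒∈ (inj₂ (inj₂ (_ , _ , a∈b)))     = a∈b

  _∋ᴺ_ : M → M → Set
  b ∋ᴺ a = a ∈ᴺ b

  HereditarilyGood : M → Set
  HereditarilyGood b = {a : M} → Star _∋ᴺ_ b a → Good a

  AllHereditarilyGood : M → Set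
  AllHereditarilyGood s = {a : M} → a ∈ s → HereditarilyGood a

  HG⇒Good : {b : M} → HereditarilyGood b → Good b
  HG⇒Good hg = hg ε

  HG-∈ᴺ : {a b : M} → HereditarilyGood b → a ∈ᴺ b → HereditarilyGood a
  HG-∈ᴺ hg a∈b path = hg (a∈b ◅ path)

  HG-intro : {b : M} → Good b → ({a : M} → a ∈ᴺ b → HereditarilyGood a) → HereditarilyGood b
  HG-intro good _       ε              = good
  HG-intro _    members (a∈b ◅ path) = members a∈b path

  HG-⌜⌝ : (y : M) → HereditarilyGood ⌜ y ⌝
  HG-⌜⌝ y ε = Good-⌜⌝ y
  HG-⌜⌝ y (a∈⌜y⌝ ◅ path) with ∈ᴺ-⌜⌝⁻ a∈⌜y⌝
  ... | z , _ , refl = HG-⌜⌝ z path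

  HG-⋆ : HereditarilyGood ⋆
  HG-⋆ ε = Good-⋆
  HG-⋆ (a∈⋆ ◅ path) with ∈ᴺ-⋆⁻ a∈⋆
  ... | refl = HG-⋆ path

  HG-plain : {b : M} → ¬ IsCode b → ¬ b ≡ ⋆ → Good b → AllHereditarilyGood b → HereditarilyGood b
  HG-plain ¬code ¬atom good b-hg = HG-intro good (b-hg ∘ to (∈ᴺ-plain ¬code ¬atom))

  ⌜⌝∈F : Δ₀ 3
  ⌜⌝∈F = ∃∈ (# 1) (UPairF (# 0) (# 3) (# 1))

  decode : M → M
  decode s = sep ⌜⌝∈F (s ∷ₑ (∅ ∷ₑ λ ())) (⋃ s)

  ∈ᴺ-⌜decode⌝ : {s : M} → ({a : M} → a ∈ s → IsCode a) → (a : M) → a ∈ᴺ ⌜ decode s ⌝ ⇔ a ∈ s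
  ∈ᴺ-⌜decode⌝ {s} s-codes a = mk⇔ ∈⌜decode⌝⇒∈ ∈⇒∈⌜decode⌝
    where
    ∈⌜decode⌝⇒∈ : a ∈ᴺ ⌜ decode s ⌝ → a ∈ s
    ∈⌜decode⌝⇒∈ a∈ᴺ with ∈ᴺ-⌜⌝⁻ a∈ᴺ
    ... | z , z∈decode , refl with ∈-sep⁻ ⌜⌝∈F z∈decode
    ...   | _ , t , t∈s , t-upair = subst (_∈ s) (IsUPair⇒≡⌜⌝ t-upair) t∈s
    ∈⇒∈⌜decode⌝ : a ∈ s → a ∈ᴺ ⌜ decode s ⌝
    ∈⇒∈⌜decode⌝ a∈s with s-codes a∈s
    ... | y , y∈a , a-upair =
      subst (_∈ᴺ ⌜ decode s ⌝) (sym (IsUPair⇒≡⌜⌝ a-upair))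
        (∈ᴺ-⌜⌝⁺ (∈-sep⁺ ⌜⌝∈F (∈-⋃⁺ a∈s y∈a) (a , a∈s , a-upair)))

  ∈ᴺ-⋆-comprehension : {s c : M} → c ∈ s → ({a : M} → a ∈ s → a ≡ ⋆) → (a : M) → a ∈ᴺ ⋆ ⇔ a ∈ s
  ∈ᴺ-⋆-comprehension {s} c∈s s-⋆ a = mk⇔
    (λ a∈ᴺ⋆ → subst (_∈ s) (trans (s-⋆ c∈s) (sym (∈ᴺ-⋆⁻ a∈ᴺ⋆))) c∈s)
    (λ a∈s → subst (_∈ᴺ ⋆) (sym (s-⋆ a∈s)) ⋆∈ᴺ⋆)

  ∈ᴺ-comprehension : (s : M) → AllHereditarilyGood s →
    Σ M λ c → HereditarilyGood c × ((a : M) → a ∈ᴺ c ⇔ a ∈ s)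
  ∈ᴺ-comprehension s s-hg with em {Σ M λ c → c ∈ s × ¬ IsCode c}
  ... | no ¬noncode =
    ⌜ decode s ⌝ , HG-⌜⌝ (decode s) , ∈ᴺ-⌜decode⌝ λ a∈s → dne λ ¬code → ¬noncode (_ , a∈s , ¬code)
  ... | yes noncode@(c , c∈s , _) with em {Σ M λ c → c ∈ s × ¬ c ≡ ⋆}
  ...   | no ¬non⋆ = ⋆ , HG-⋆ , ∈ᴺ-⋆-comprehension c∈s λ a∈s → dne λ a≢⋆ → ¬non⋆ (_ , a∈s , a≢⋆)
  ...   | yes non⋆ = s , HG-plain ¬code ¬atom (noncode , non⋆) s-hg , λ a → ∈ᴺ-plain ¬code ¬atom
    -- s is plain because neither ∅, a member of every code, nor {{∅}}, the member of ⋆, is good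
    where
    ¬code : ¬ IsCode s
    ¬code (_ , _ , ∅∈s , _) = ¬Good-∅ (HG⇒Good (s-hg ∅∈s))
    ¬atom : ¬ s ≡ ⋆
    ¬atom refl = ¬Good-sing²∅ (HG⇒Good (s-hg (∈-sing _)))

  _⊆ᴺ_ : M → M → Set
  a ⊆ᴺ b = {c : M} → HereditarilyGood c → c ∈ᴺ a → c ∈ᴺ b

  ⌜⌝-⊆ᴺ⁻ : {y y′ : M} → ⌜ y ⌝ ⊆ᴺ ⌜ y′ ⌝ → (z : M) → z ∈ y → z ∈ y′
  ⌜⌝-⊆ᴺ⁻ ⌜y⌝⊆⌜y′⌝ z z∈y with ∈ᴺ-⌜⌝⁻ (⌜y⌝⊆⌜y′⌝ (HG-⌜⌝ z) (∈ᴺ-⌜⌝⁺ z∈y))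
  ... | z′ , z′∈y′ , ⌜z⌝≡⌜z′⌝ = subst (_∈ _) (sym (⌜⌝-injective ⌜z⌝≡⌜z′⌝)) z′∈y′

  ⋆⊈ᴺ⌜⌝ : {y : M} → ¬ (⋆ ⊆ᴺ ⌜ y ⌝)
  ⋆⊈ᴺ⌜⌝ ⋆⊆⌜y⌝ with ∈ᴺ-⌜⌝⁻ (⋆⊆⌜y⌝ HG-⋆ ⋆∈ᴺ⋆)
  ... | z , _ , ⋆≡⌜z⌝ = ¬IsCode-⋆ (subst IsCode (sym ⋆≡⌜z⌝) (⌜⌝-IsCode z))

  plain⊈ᴺ⌜⌝ : {b y : M} → ¬ IsCode b → ¬ b ≡ ⋆ → HereditarilyGood b → ¬ (b ⊆ᴺ ⌜ y ⌝)
  plain⊈ᴺ⌜⌝ ¬code ¬atom hg b⊆⌜y⌝ with proj₁ (HG⇒Good hg)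
  ... | c , c∈b , ¬code-c with from (∈ᴺ-plain ¬code ¬atom) c∈b
  ...   | c∈ᴺb with ∈ᴺ-⌜⌝⁻ (b⊆⌜y⌝ (HG-∈ᴺ hg c∈ᴺb) c∈ᴺb)
  ...     | z , _ , c≡⌜z⌝ = ¬code-c (subst IsCode (sym c≡⌜z⌝) (⌜⌝-IsCode z))

  plain⊈ᴺ⋆ : {b : M} → ¬ IsCode b → ¬ b ≡ ⋆ → HereditarilyGood b → ¬ (b ⊆ᴺ ⋆)
  plain⊈ᴺ⋆ ¬code ¬atom hg b⊆⋆ with proj₂ (HG⇒Good hg)
  ... | c , c∈b , c≢⋆ with from (∈ᴺ-plain ¬code ¬atom) c∈b
  ...   | c∈ᴺb = c≢⋆ (∈ᴺ-⋆⁻ (b⊆⋆ (HG-∈ᴺ hg c∈ᴺb) c∈ᴺb))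

  plain-⊆ᴺ⁻ : {a b : M} → ¬ IsCode a → ¬ a ≡ ⋆ → ¬ IsCode b → ¬ b ≡ ⋆ → HereditarilyGood a →
              a ⊆ᴺ b → (z : M) → z ∈ a → z ∈ b
  plain-⊆ᴺ⁻ ¬code-a ¬atom-a ¬code-b ¬atom-b hg a⊆b z z∈a =
    to (∈ᴺ-plain ¬code-b ¬atom-b) (a⊆b (HG-∈ᴺ hg z∈ᴺa) z∈ᴺa)
    where
    z∈ᴺa : z ∈ᴺ _
    z∈ᴺa = from (∈ᴺ-plain ¬code-a ¬atom-a) z∈a

  ⊆ᴺ-antisym : {a b : M} → Kind a → Kind b → HereditarilyGood a → HereditarilyGood b →
               a ⊆ᴺ b → b ⊆ᴺ a → a ≡ b
  ⊆ᴺ-antisym (code _)      (code _)      _    _    p q = cong ⌜_⌝ (extensional (⌜⌝-⊆ᴺ⁻ p) (⌜⌝-⊆ᴺ⁻ q))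
  ⊆ᴺ-antisym (code _)      atom          _    _    _ q = ⊥-elim (⋆⊈ᴺ⌜⌝ q)
  ⊆ᴺ-antisym (code _)      (plain ¬c ¬a) _    hg-b _ q = ⊥-elim (plain⊈ᴺ⌜⌝ ¬c ¬a hg-b q)
  ⊆ᴺ-antisym atom          (code _)      _    _    p _ = ⊥-elim (⋆⊈ᴺ⌜⌝ p)
  ⊆ᴺ-antisym atom          atom          _    _    _ _ = refl
  ⊆ᴺ-antisym atom          (plain ¬c ¬a) _    hg-b _ q = ⊥-elim (plain⊈ᴺ⋆ ¬c ¬a hg-b q)
  ⊆ᴺ-antisym (plain ¬c ¬a) (code _)      hg-a _    p _ = ⊥-elim (plain⊈ᴺ⌜⌝ ¬c ¬a hg-a p)
  ⊆ᴺ-antisym (plain ¬c ¬a) atom          hg-a _    p _ = ⊥-elim (plain⊈ᴺ⋆ ¬c ¬a hg-a p)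
  ⊆ᴺ-antisym (plain ¬c ¬a) (plain ¬c′ ¬a′) hg-a hg-b p q =
    extensional (plain-⊆ᴺ⁻ ¬c ¬a ¬c′ ¬a′ hg-a p) (plain-⊆ᴺ⁻ ¬c′ ¬a′ ¬c ¬a hg-b q)

  ∈ᴺ-extensional : {a b : M} → HereditarilyGood a → HereditarilyGood b → a ⊆ᴺ b → b ⊆ᴺ a → a ≡ b
  ∈ᴺ-extensional {a} {b} = ⊆ᴺ-antisym (kind a) (kind b)

  ⌜⌝-∈-⋃sing∅⊗ : {z Z : M} → z ∈ Z → ⌜ z ⌝ ∈ ⋃ (sing ∅ ⊗ Z)
  ⌜⌝-∈-⋃sing∅⊗ z∈Z = IsUPair-∈-⋃⊗ (∈-sing ∅) z∈Z (⌜⌝-IsUPair _)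

  ∈-⋃sing∅⊗⇒IsCode : {t Z : M} → t ∈ ⋃ (sing ∅ ⊗ Z) → IsCode t
  ∈-⋃sing∅⊗⇒IsCode t∈ with ∈-⋃⊗⁻ t∈
  ... | u , v , u∈sing∅ , _ , t-upair rewrite ∈-sing⁻ u∈sing∅ = v , proj₁ (proj₂ t-upair) , t-upair

  -- Codes ⌜z⌝ with z ∈ ⋃ (⋃ A) are collected as members of the pairs ⟨∅, z⟩.
  ∈ᴺ-step : M → M
  ∈ᴺ-step A = A ∪ ⋃ A ∪ sing ⋆ ∪ ⋃ (sing ∅ ⊗ ⋃ (⋃ A))

  ⊆-∈ᴺ-step : {A a : M} → a ∈ A → a ∈ ∈ᴺ-step A
  ⊆-∈ᴺ-step = ∈-∪⁺ˡ ∘ ∈-∪⁺ˡ ∘ ∈-∪⁺ˡ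

  ∈ᴺ-∈-∈ᴺ-step : {A a b : M} → b ∈ A → a ∈ᴺ b → a ∈ ∈ᴺ-step A
  ∈ᴺ-∈-∈ᴺ-step b∈A (inj₁ (y , y∈b , _ , z , z∈y , a-upair)) rewrite IsUPair⇒≡⌜⌝ a-upair =
    ∈-∪⁺ʳ (⌜⌝-∈-⋃sing∅⊗ (∈-⋃⁺ (∈-⋃⁺ b∈A y∈b) z∈y))
  ∈ᴺ-∈-∈ᴺ-step b∈A (inj₂ (inj₁ (_ , refl)))       = ∈-∪⁺ˡ (∈-∪⁺ʳ (∈-sing ⋆))
  ∈ᴺ-∈-∈ᴺ-step b∈A (inj₂ (inj₂ (_ , _ , a∈b)))   = ∈-∪⁺ˡ (∈-∪⁺ˡ (∈-∪⁺ʳ (∈-⋃⁺ b∈A a∈b)))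

  ∈ᴺ-stepⁿ : ℕ → M → M
  ∈ᴺ-stepⁿ zero    A = A
  ∈ᴺ-stepⁿ (suc j) A = ∈ᴺ-stepⁿ j (∈ᴺ-step A)

  ⊆-∈ᴺ-stepⁿ : (j : ℕ) {A a : M} → a ∈ A → a ∈ ∈ᴺ-stepⁿ j A
  ⊆-∈ᴺ-stepⁿ zero    a∈A = a∈A
  ⊆-∈ᴺ-stepⁿ (suc j) a∈A = ⊆-∈ᴺ-stepⁿ j (⊆-∈ᴺ-step a∈A)

  Bounded : M → ℕ → M → Set
  Bounded S zero    b = ⊤
  Bounded S (suc r) b = {a : M} → a ∈ᴺ b → a ∈ S × Bounded S r a

  Bounded-suc⁻ : {S b : M} (r : ℕ) → Bounded S (suc r) b → Bounded S r b
  Bounded-suc⁻ zero    _       = tt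
  Bounded-suc⁻ (suc r) bounded a∈b = proj₁ (bounded a∈b) , Bounded-suc⁻ r (proj₂ (bounded a∈b))

  Bounded-∈ᴺ-stepⁿ : (j : ℕ) {A S b : M} → ({a : M} → a ∈ ∈ᴺ-stepⁿ j A → a ∈ S) → b ∈ A → Bounded S j b
  Bounded-∈ᴺ-stepⁿ zero    _ _ = tt
  Bounded-∈ᴺ-stepⁿ (suc j) ⊆S b∈A a∈b =
    ⊆S (⊆-∈ᴺ-stepⁿ j (∈ᴺ-∈-∈ᴺ-step b∈A a∈b)) , Bounded-∈ᴺ-stepⁿ j ⊆S (∈ᴺ-∈-∈ᴺ-step b∈A a∈b)


  N : Set
  N = [ b ∈ M ∣ HereditarilyGood b ]

  -- The proof component of N is irrelevant; excluded middle makes it available again.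
  hg : (x : N) → HereditarilyGood (value x)
  hg (b , [ b-hg ]) = dne λ ¬hg → Irrelevant.⊥-elim (¬hg b-hg)

  _∈N_ : N → N → Set
  x ∈N y = value x ∈ᴺ value y

  𝓝 : Structure
  𝓝 = record { Carrier = N ; _∈_ = _∈N_ }

  depth : {n : ℕ} → Δ₀ n → ℕ
  depth (_ ∈' _) = zero
  depth (_ ≐ _)  = zero
  depth ⊥'       = zero
  depth (φ ⇒ ψ)  = depth φ ⊔ depth ψ
  depth (φ ∧' ψ) = depth φ ⊔ depth ψ
  depth (φ ∨' ψ) = depth φ ⊔ depth ψ
  depth (∀∈ _ φ) = suc (depth φ)
  depth (∃∈ _ φ) = suc (depth φ)

  -- An 𝓝-formula in n variables becomes an 𝓜-formula in n + 3 variables: the last three hold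
  -- the bounding set S, ∅ and ⋆.  Being outermost, they are shifted correctly under binders.
  var : {n : ℕ} → Fin n → Fin (n + 3)
  var i = i ↑ˡ 3

  S-var ∅-var ⋆-var : {n : ℕ} → Fin (n + 3)
  S-var {n} = n ↑ʳ # 0
  ∅-var {n} = n ↑ʳ # 1
  ⋆-var {n} = n ↑ʳ # 2

  _∈ᵀ_ : {n : ℕ} → Fin n → Fin n → Δ₀ (n + 3)
  i ∈ᵀ j = ∈ᴺF (var i) (var j) ∅-var ⋆-var

  translate : {n : ℕ} → Δ₀ n → Δ₀ (n + 3)
  translate (i ∈' j)       = i ∈ᵀ j
  translate (i ≐ j)        = var i ≐ var j
  translate ⊥'             = ⊥'
  translate (φ ⇒ ψ)        = translate φ ⇒ translate ψ
  translate (φ ∧' ψ)       = translate φ ∧' translate ψ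
  translate (φ ∨' ψ)       = translate φ ∨' translate ψ
  translate {n} (∀∈ i φ)   = ∀∈ (S-var {n}) ((zero ∈ᵀ suc i) ⇒ translate φ)
  translate {n} (∃∈ i φ)   = ∃∈ (S-var {n}) ((zero ∈ᵀ suc i) ∧' translate φ)

  record Agrees {n : ℕ} (S : M) (r : ℕ) (σ : Fin (n + 3) → M) (ρ : Fin n → N) : Set where
    field
      var≡    : (i : Fin n) → σ (var i) ≡ value (ρ i)
      S-var≡  : σ (S-var {n}) ≡ S
      ∅-var≡  : σ (∅-var {n}) ≡ ∅
      ⋆-var≡  : σ (⋆-var {n}) ≡ ⋆
      bounded : (i : Fin n) → Bounded S r (value (ρ i))

  Agrees-∷ : {n : ℕ} {S : M} {r : ℕ} {σ : Fin (n + 3) → M} {ρ : Fin n → N} →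
             Agrees S (suc r) σ ρ → (y : N) → Bounded S r (value y) →
             Agrees S r (value y ∷ₑ σ) (y ∷ₑ ρ)
  Agrees-∷ {r = r} ag y y-bounded = record
    { var≡    = λ { zero → refl ; (suc i) → var≡ i }
    ; S-var≡  = S-var≡
    ; ∅-var≡  = ∅-var≡
    ; ⋆-var≡  = ⋆-var≡
    ; bounded = λ { zero → y-bounded ; (suc i) → Bounded-suc⁻ r (bounded i) }
    }
    where open Agrees ag

  ∈ᴺ-cong : {e o a a′ b b′ : M} → e ≡ ∅ → o ≡ ⋆ → a ≡ a′ → b ≡ b′ → Coding._∈ᴺ_ e o a b ⇔ a′ ∈ᴺ b′
  ∈ᴺ-cong refl refl refl refl = ⇔-id _

  module Guarded {n : ℕ} {S : M} {r : ℕ} {σ : Fin (n + 3) → M} {ρ : Fin n → N}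
                 (ag : Agrees S (suc r) σ ρ) (i : Fin n) where
    open Agrees ag

    guard : (a : M) → Sat 𝓜 (zero ∈ᵀ suc i) (a ∷ₑ σ) ⇔ a ∈ᴺ value (ρ i)
    guard a = ∈ᴺ-cong ∅-var≡ ⋆-var≡ refl (var≡ i)

    ∈S-var : (y : N) → y ∈N ρ i → value y ∈ σ (S-var {n})
    ∈S-var _ y∈ρi = subst (_ ∈_) (sym S-var≡) (proj₁ (bounded i y∈ρi))

    member : {a : M} → a ∈ᴺ value (ρ i) → N
    member {a} a∈ρi = a , [ HG-∈ᴺ (hg (ρ i)) a∈ρi ]

    member-agrees : {a : M} (a∈ρi : a ∈ᴺ value (ρ i)) → Agrees S r (a ∷ₑ σ) (member a∈ρi ∷ₑ ρ)
    member-agrees a∈ρi = Agrees-∷ ag (member a∈ρi) (proj₂ (bounded i a∈ρi))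

  Sat-translate : {n : ℕ} (φ : Δ₀ n) {S : M} {r : ℕ} {σ : Fin (n + 3) → M} {ρ : Fin n → N} →
                      depth φ ≤ r → Agrees S r σ ρ → Sat 𝓜 (translate φ) σ ⇔ Sat 𝓝 φ ρ
  Sat-translate (i ∈' j) _ ag = ∈ᴺ-cong ∅-var≡ ⋆-var≡ (var≡ i) (var≡ j)
    where open Agrees ag
  Sat-translate (i ≐ j) _ ag = mk⇔
    (λ eq → value-injective (trans (sym (var≡ i)) (trans eq (var≡ j))))
    (λ eq → trans (var≡ i) (trans (cong value eq) (sym (var≡ j))))
    where open Agrees ag
  Sat-translate ⊥' _ _ = ⇔-id _
  Sat-translate (φ ⇒ ψ) d ag =
    →-cong-⇔ (Sat-translate φ (m⊔n≤o⇒m≤o _ _ d) ag) (Sat-translate ψ (m⊔n≤o⇒n≤o _ _ d) ag)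
  Sat-translate (φ ∧' ψ) d ag =
    Sat-translate φ (m⊔n≤o⇒m≤o _ _ d) ag ×-⇔ Sat-translate ψ (m⊔n≤o⇒n≤o _ _ d) ag
  Sat-translate (φ ∨' ψ) d ag =
    Sat-translate φ (m⊔n≤o⇒m≤o _ _ d) ag ⊎-⇔ Sat-translate ψ (m⊔n≤o⇒n≤o _ _ d) ag
  Sat-translate (∀∈ i φ) {σ = σ} {ρ} (s≤s d) ag = mk⇔
    (λ h y y∈ρi → to (body y∈ρi) (h (value y) (∈S-var y y∈ρi) (from (guard (value y)) y∈ρi)))
    (λ h a _ a∈ᵀρi → let a∈ρi = to (guard a) a∈ᵀρi in from (body a∈ρi) (h (member a∈ρi) a∈ρi))
    where
    open Guarded ag i
    body : {a : M} (a∈ρi : a ∈ᴺ value (ρ i)) → Sat 𝓜 (translate φ) (a ∷ₑ σ) ⇔ Sat 𝓝 φ (member a∈ρi ∷ₑ ρ)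
    body a∈ρi = Sat-translate φ d (member-agrees a∈ρi)
  Sat-translate (∃∈ i φ) {σ = σ} {ρ} (s≤s d) ag = mk⇔
    (λ (a , _ , a∈ᵀρi , sat) → let a∈ρi = to (guard a) a∈ᵀρi in member a∈ρi , a∈ρi , to (body a∈ρi) sat)
    (λ (y , y∈ρi , sat) → value y , ∈S-var y y∈ρi , from (guard (value y)) y∈ρi , from (body y∈ρi) sat)
    where
    open Guarded ag i
    body : {a : M} (a∈ρi : a ∈ᴺ value (ρ i)) → Sat 𝓜 (translate φ) (a ∷ₑ σ) ⇔ Sat 𝓝 φ (member a∈ρi ∷ₑ ρ)
    body a∈ρi = Sat-translate φ d (member-agrees a∈ρi)

  comprehensionᴺ : (s : M) → AllHereditarilyGood s → Σ N λ c → (x : N) → x ∈N c ⇔ value x ∈ s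
  comprehensionᴺ s s-hg with ∈ᴺ-comprehension s s-hg
  ... | c , c-hg , ∈c = (c , [ c-hg ]) , λ x → ∈c (value x)

  members : (x : N) → Σ M λ X → AllHereditarilyGood X × ((a : M) → a ∈ X ⇔ a ∈ᴺ value x)
  members x = X , (λ a∈X → HG-∈ᴺ (hg x) (proj₂ (∈-sep⁻ φ a∈X))) ,
              λ a → mk⇔ (proj₂ ∘ ∈-sep⁻ φ) (λ a∈x → ∈-sep⁺ φ (∈ᴺ-∈-∈ᴺ-step (∈-sing (value x)) a∈x) a∈x)
    where
    φ : Δ₀ 4
    φ = ∈ᴺF (# 0) (# 1) (# 2) (# 3)
    X : M
    X = sep φ (value x ∷ₑ (∅ ∷ₑ (⋆ ∷ₑ λ ()))) (∈ᴺ-step (sing (value x)))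

  ⌜_⌝ᴺ : M → N
  ⌜ m ⌝ᴺ = ⌜ m ⌝ , [ HG-⌜⌝ m ]

  𝓝-extensionality : Extensionality 𝓝
  𝓝-extensionality x y x≈y = value-injective (∈ᴺ-extensional (hg x) (hg y)
    (λ {c} c-hg → to (x≈y (c , [ c-hg ])))
    (λ {c} c-hg → from (x≈y (c , [ c-hg ]))))

  𝓝-nullset : Σ N λ x → (y : N) → ¬ (y ∈N x)
  𝓝-nullset = ⌜ ∅ ⌝ᴺ , λ y y∈⌜∅⌝ → ∉∅ (proj₁ (proj₂ (∈ᴺ-⌜⌝⁻ y∈⌜∅⌝)))

  AllHG-pair : (x y : N) → AllHereditarilyGood (pair (value x) (value y))
  AllHG-pair x y a∈ with ∈-pair⁻ a∈
  ... | inj₁ refl = hg x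
  ... | inj₂ refl = hg y

  𝓝-pairing : (x y : N) → Σ N λ z → (w : N) → w ∈N z ⇔ (w ≡ x ⊎ w ≡ y)
  𝓝-pairing x y with comprehensionᴺ (pair (value x) (value y)) (AllHG-pair x y)
  ... | z , ∈z = z , λ w → mk⇔
    (Sum.map value-injective value-injective ∘ ∈-pair⁻ ∘ to (∈z w))
    (from (∈z w) ∘ ∈-pair⁺ ∘ Sum.map (cong value) (cong value))

  ∈ᴺ⋃F : Δ₀ 4
  ∈ᴺ⋃F = ∃∈ (# 1) (∈ᴺF (# 1) (# 0) (# 3) (# 4))

  ∈ᴺ-⋃ : M → M
  ∈ᴺ-⋃ X = sep ∈ᴺ⋃F (X ∷ₑ (∅ ∷ₑ (⋆ ∷ₑ λ ()))) (∈ᴺ-step X)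

  ∈-∈ᴺ-⋃ : {X a : M} → a ∈ ∈ᴺ-⋃ X ⇔ (Σ M λ u → u ∈ X × a ∈ᴺ u)
  ∈-∈ᴺ-⋃ = mk⇔ (proj₂ ∘ ∈-sep⁻ ∈ᴺ⋃F)
                λ (u , u∈X , a∈u) → ∈-sep⁺ ∈ᴺ⋃F (∈ᴺ-∈-∈ᴺ-step u∈X a∈u) (u , u∈X , a∈u)

  AllHG-∈ᴺ-⋃ : {X : M} → AllHereditarilyGood X → AllHereditarilyGood (∈ᴺ-⋃ X)
  AllHG-∈ᴺ-⋃ X-hg a∈ = let (u , u∈X , a∈u) = to ∈-∈ᴺ-⋃ a∈ in HG-∈ᴺ (X-hg u∈X) a∈u

  𝓝-union : (x : N) → Σ N λ z → (w : N) → w ∈N z ⇔ (Σ N λ u → u ∈N x × w ∈N u)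
  𝓝-union x with members x
  ... | X , X-hg , ∈X with comprehensionᴺ (∈ᴺ-⋃ X) (AllHG-∈ᴺ-⋃ X-hg)
  ...   | z , ∈z = z , λ w → mk⇔
    (λ w∈z → let (u , u∈X , w∈u) = to ∈-∈ᴺ-⋃ (to (∈z w) w∈z) in
             (u , [ X-hg u∈X ]) , to (∈X u) u∈X , w∈u)
    (λ (u , u∈x , w∈u) → from (∈z w) (from ∈-∈ᴺ-⋃ (value u , from (∈X (value u)) u∈x , w∈u)))

  module Relativisation {n : ℕ} (φ : Δ₀ (suc n)) (ps : Fin n → N) (X : M) where

    S : M
    S = ∈ᴺ-stepⁿ (depth φ) (X ∪ proj₁ (enumerate (value ∘ ps)))

    params : Fin (n + 3) → M
    params = (value ∘ ps) ++ (S ∷ₑ (∅ ∷ₑ (⋆ ∷ₑ λ ())))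

    agrees : (w : N) → value w ∈ X → Agrees S (depth φ) (value w ∷ₑ params) (w ∷ₑ ps)
    agrees w w∈X = record
      { var≡    = λ { zero → refl ; (suc i) → lookup-++ˡ (value ∘ ps) _ i }
      ; S-var≡  = lookup-++ʳ (value ∘ ps) _ (# 0)
      ; ∅-var≡  = lookup-++ʳ (value ∘ ps) _ (# 1)
      ; ⋆-var≡  = lookup-++ʳ (value ∘ ps) _ (# 2)
      ; bounded = λ { zero    → Bounded-∈ᴺ-stepⁿ (depth φ) id (∈-∪⁺ˡ w∈X)
                    ; (suc i) → Bounded-∈ᴺ-stepⁿ (depth φ) id
                                  (∈-∪⁺ʳ (proj₂ (enumerate (value ∘ ps)) i)) }
      }

    ∈-sep-translate : (w : N) → value w ∈ sep (translate φ) params X ⇔ (value w ∈ X × Sat 𝓝 φ (w ∷ₑ ps))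
    ∈-sep-translate w = mk⇔
      (λ w∈ → let (w∈X , sat) = ∈-sep⁻ (translate φ) w∈ in w∈X , to (correct w∈X) sat)
      (λ (w∈X , sat) → ∈-sep⁺ (translate φ) w∈X (from (correct w∈X) sat))
      where
      correct : value w ∈ X → Sat 𝓜 (translate φ) (value w ∷ₑ params) ⇔ Sat 𝓝 φ (w ∷ₑ ps)
      correct w∈X = Sat-translate φ ≤-refl (agrees w w∈X)

    relativised-separation : AllHereditarilyGood X →
      Σ N λ z → (w : N) → w ∈N z ⇔ (value w ∈ X × Sat 𝓝 φ (w ∷ₑ ps))
    relativised-separation X-hg
      with comprehensionᴺ (sep (translate φ) params X) (X-hg ∘ proj₁ ∘ ∈-sep⁻ (translate φ))
    ... | z , ∈z = z , λ w → ⇔-trans (∈z w) (∈-sep-translate w)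

  𝓝-separation : Δ₀-Separation 𝓝
  𝓝-separation φ ps x with members x
  ... | X , X-hg , ∈X with Relativisation.relativised-separation φ ps X X-hg
  ...   | z , ∈z = z , λ w → ⇔-trans (∈z w) (∈X (value w) ×-⇔ ⇔-id _)

  IsUPairᴺ : M → M → M → Set
  IsUPairᴺ t a b = a ∈ᴺ t × b ∈ᴺ t × ({c : M} → HereditarilyGood c → c ∈ᴺ t → c ≡ a ⊎ c ≡ b)

  IsUPair𝓝⇒IsUPairᴺ : {t u v : N} → IsUPair 𝓝 t u v → IsUPairᴺ (value t) (value u) (value v)
  IsUPair𝓝⇒IsUPairᴺ (u∈t , v∈t , only) =
    u∈t , v∈t , λ {c} c-hg c∈t → Sum.map (cong value) (cong value) (only (c , [ c-hg ]) c∈t)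

  pairs-superset : M → M → M
  pairs-superset X Y = ⋃ (X ⊗ Y) ∪ sing ⋆ ∪ ⋃ (sing ∅ ⊗ ⋃ (⋃ X ⊗ ⋃ Y))

  IsUPairᴺ-∈-pairs-superset : {X Y t a b : M} → Kind t → HereditarilyGood t → a ∈ X → b ∈ Y →
                              IsUPairᴺ t a b → t ∈ pairs-superset X Y
  IsUPairᴺ-∈-pairs-superset (code y) _ a∈X b∈Y (a∈t , b∈t , only)
    with ∈ᴺ-⌜⌝⁻ a∈t | ∈ᴺ-⌜⌝⁻ b∈t
  ... | za , za∈y , refl | zb , zb∈y , refl =
    ∈-∪⁺ʳ (⌜⌝-∈-⋃sing∅⊗ (IsUPair-∈-⋃⊗ (∈-⋃⁺ a∈X ∈-pair⁺ʳ) (∈-⋃⁺ b∈Y ∈-pair⁺ʳ) (za∈y , zb∈y , decoded)))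
    where
    decoded : (z : M) → z ∈ y → z ≡ za ⊎ z ≡ zb
    decoded z z∈y = Sum.map ⌜⌝-injective ⌜⌝-injective (only (HG-⌜⌝ z) (∈ᴺ-⌜⌝⁺ z∈y))
  IsUPairᴺ-∈-pairs-superset atom _ _ _ _ = ∈-∪⁺ˡ (∈-∪⁺ʳ (∈-sing ⋆))
  IsUPairᴺ-∈-pairs-superset {t = t} (plain ¬code ¬atom) t-hg a∈X b∈Y (a∈t , b∈t , only) =
    ∈-∪⁺ˡ (∈-∪⁺ˡ (IsUPair-∈-⋃⊗ a∈X b∈Y
      (to ∈ᴺ⇔∈ a∈t , to ∈ᴺ⇔∈ b∈t , λ c c∈t → only (HG-∈ᴺ t-hg (from ∈ᴺ⇔∈ c∈t)) (from ∈ᴺ⇔∈ c∈t))))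
    where
    ∈ᴺ⇔∈ : {c : M} → c ∈ᴺ t ⇔ c ∈ t
    ∈ᴺ⇔∈ = ∈ᴺ-plain ¬code ¬atom

  pairs-superset-plain : {X Y t c : M} → ¬ IsCode t → ¬ t ≡ ⋆ → t ∈ pairs-superset X Y →
                         c ∈ t → c ∈ X ⊎ c ∈ Y
  pairs-superset-plain ¬code ¬atom t∈ c∈t with ∈-∪⁻ t∈
  ... | inj₂ t∈codes = ⊥-elim (¬code (∈-⋃sing∅⊗⇒IsCode t∈codes))
  ... | inj₁ t∈ with ∈-∪⁻ t∈
  ...   | inj₂ t∈sing⋆ = ⊥-elim (¬atom (∈-sing⁻ t∈sing⋆))
  ...   | inj₁ t∈⋃X⊗Y with ∈-⋃⊗⁻ t∈⋃X⊗Y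
  ...     | u , v , u∈X , v∈XY , (_ , _ , only) with only _ c∈t | v∈XY
  ...       | inj₁ refl | _ = inj₁ u∈X
  ...       | inj₂ refl | v∈X⊎Y = v∈X⊎Y

  good-pairs : M → M → M
  good-pairs X Y = sep (GoodF) (∅ ∷ₑ (⋆ ∷ₑ λ ())) (pairs-superset X Y)

  AllHG-good-pairs : {X Y : M} → AllHereditarilyGood X → AllHereditarilyGood Y →
                     AllHereditarilyGood (good-pairs X Y)
  AllHG-good-pairs {X} {Y} X-hg Y-hg {t} t∈ = by-kind (kind t) (∈-sep⁻ (GoodF) t∈)
    where
    by-kind : {t : M} → Kind t → t ∈ pairs-superset X Y × Good t → HereditarilyGood t
    by-kind (code y)            _             = HG-⌜⌝ y
    by-kind atom                _             = HG-⋆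
    by-kind (plain ¬code ¬atom) (t∈ , t-good) =
      HG-plain ¬code ¬atom t-good λ c∈t → Sum.[ X-hg , Y-hg ]′ (pairs-superset-plain ¬code ¬atom t∈ c∈t)

  IsUPair-∈-good-pairs : {X Y : M} (t u v : N) → value u ∈ X → value v ∈ Y → IsUPair 𝓝 t u v →
                         value t ∈ good-pairs X Y
  IsUPair-∈-good-pairs t u v u∈X v∈Y t-upair =
    ∈-sep⁺ GoodF
      (IsUPairᴺ-∈-pairs-superset (kind (value t)) (hg t) u∈X v∈Y (IsUPair𝓝⇒IsUPairᴺ {t} {u} {v} t-upair))
      (HG⇒Good (hg t))

  opairs-bound : (X Y : M) → AllHereditarilyGood X → AllHereditarilyGood Y →
    Σ M λ B → AllHereditarilyGood B ×
      ((w u v : N) → value u ∈ X → value v ∈ Y → IsOPair 𝓝 w u v → value w ∈ B)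
  opairs-bound X Y X-hg Y-hg =
    good-pairs (good-pairs X X) (good-pairs X Y) ,
    AllHG-good-pairs (AllHG-good-pairs X-hg X-hg) (AllHG-good-pairs X-hg Y-hg) ,
    λ w u v u∈X v∈Y w≡⟨u,v⟩ →
      let (s , p , s-upair , p-upair , w-upair) =
            StructureProperties.IsOPair-unfold 𝓝 𝓝-extensionality {w} {u} {v} w≡⟨u,v⟩
      in IsUPair-∈-good-pairs w s p (IsUPair-∈-good-pairs s u u u∈X u∈X s-upair)
                                    (IsUPair-∈-good-pairs p u v u∈X v∈Y p-upair) w-upair

  𝓝-product : (x y : N) → Σ N λ z → (w : N) → w ∈N z ⇔
                (Σ N λ u → Σ N λ v → u ∈N x × v ∈N y × IsOPair 𝓝 w u v)
  𝓝-product x y with members x | members y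
  ... | X , X-hg , ∈X | Y , Y-hg , ∈Y with opairs-bound X Y X-hg Y-hg
  ...   | B , B-hg , opairs∈B with comprehensionᴺ B B-hg
  ...     | p , ∈p = StructureProperties.product-from-bound 𝓝 𝓝-separation x y p
    λ w u v u∈x v∈y w≡⟨u,v⟩ → from (∈p w) (opairs∈B w u v (from (∈X _) u∈x) (from (∈Y _) v∈y) w≡⟨u,v⟩)

  𝓝-model : ModelDB₀ 𝓝
  𝓝-model = record
    { extensionality = 𝓝-extensionality
    ; nullset        = 𝓝-nullset
    ; pairing        = 𝓝-pairing
    ; union          = 𝓝-union
    ; product        = 𝓝-product
    ; Δ₀-separation  = 𝓝-separation
    }

  ⌜⌝ᴺ-end-extension : EndExtension 𝓜 𝓝
  ⌜⌝ᴺ-end-extension = record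
    { emb       = ⌜_⌝ᴺ
    ; injective = λ _ _ → ⌜⌝-injective ∘ cong value
    ; ∈-iff     = λ x y → mk⇔ ∈ᴺ-⌜⌝⁺ (λ ⌜x⌝∈⌜y⌝ → let (z , z∈y , ⌜x⌝≡⌜z⌝) = ∈ᴺ-⌜⌝⁻ ⌜x⌝∈⌜y⌝ in
                                       subst (_∈ y) (sym (⌜⌝-injective ⌜x⌝≡⌜z⌝)) z∈y)
    ; end       = λ m n n∈⌜m⌝ → let (z , _ , n≡⌜z⌝) = ∈ᴺ-⌜⌝⁻ n∈⌜m⌝ in z , value-injective (sym n≡⌜z⌝)
    }

  ⌜⌝ᴺ-proper-end-extension : ProperEndExtension 𝓜 𝓝
  ⌜⌝ᴺ-proper-end-extension = record
    { endExt = ⌜⌝ᴺ-end-extension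
    ; proper = (⋆ , [ HG-⋆ ]) , λ m ⌜m⌝≡⋆ → ¬IsCode-⋆ (subst IsCode (cong value ⌜m⌝≡⋆) (⌜⌝-IsCode m))
    }

mainTheorem4 : ExcludedMiddle 0ℓ → (𝓜 : Structure) → ModelDB₀ 𝓜 →
    Σ Structure λ 𝓝 → ModelDB₀ 𝓝 × ProperEndExtension 𝓜 𝓝
mainTheorem4 em 𝓜 MD = 𝓝 , 𝓝-model , ⌜⌝ᴺ-proper-end-extension
  where open Construction em 𝓜 MD
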